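{- Let $P$, $T$ (in conjunctive normal form $\bigwedge_{i\in I}\bigvee_{j\in J_i}T_{i,j}$), $L$ and $C_5$ be as described below. Suppose $T$ has degree $\le 0$, and let $\eta$ be a suitable coloring of $T$ with $\deg_T(\eta)=0$. Let $C_6'$ be the constraint obtained from $C_5$ by fixing Motzkin coefficients as follows: (I) in each transform from (II4), the coefficient of $\neg\psi_{\ell'}(x)$ to $\{0,1\}$; (II) in each transform from (IC4), the coefficient of $\neg\psi_{\ell'}(x')$ to $\{0,1\}$ and the coefficient of $\psi_{\ell'}(x)$ to $\{1\}$ (this encodes considering only non-decreasing invariants); (III) in each transform from (TI4) for $(i,m)$, the coefficient of $\neg T_{i,j}$ to $\{0,1\}$ for every $j$ with $T_{i,j}$ colored red or blue by $\eta$; (IV) in each transform from (TI4) for $(i,m)$, the coefficient of $\psi_{(\ell,i,m)}(x)$ to $\{0,1\}$ if $\rhd_\ell$ is $>$ and to $\{1\}$ if $\rhd_\ell$ is $\ge$. Then $C_6'$ is a formula of linear arithmetic (it contains no product of two variables).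
   Context: Fixing an existentially quantified variable $\kappa$ to a finite set $U=\{u_1,\ldots,u_r\}$ means replacing $\exists\kappa.\varphi(\kappa)$ by $\varphi(u_1)\vee\ldots\vee\varphi(u_r)$. An affine invariant $s^Tx+t\ge0$ is non-decreasing iff $\forall x,x'.\ \mathrm{loop}(x,x')\to s^Tx'-s^Tx\ge0$. Setting: $K$ is $\mathbb{Q}$ or a real closed field. $P$ is a linear lasso program over $K^n$ in normal form $\mathrm{stem}(x)\equiv\bigvee_{\nu\in N}(B_\nu x\le b_\nu\wedge B'_\nu x<b'_\nu)$, $\mathrm{loop}(x,x')\equiv\bigvee_{m\in M}(A_m(x;x')\le c_m\wedge A'_m(x;x')<c'_m)$ (finite $N,M$, constant data; $(x;x')$ stacked). $T$ is a linear ranking function template over a finite set $F$ of affine-linear function symbols ($f\in F$ stands for $x\mapsto s_f^Tx+t_f$, unknown $s_f,t_f$) and a finite set $D$ of unknown scalars: a boolean combination of atoms $\sum_f(\alpha_f f(x)+\beta_f f(x'))+\sum_d\gamma_d d\rhd0$ with constants $\alpha_f,\beta_f,\gamma_d\in K$ not all zero, $\rhd\in\{\ge,>\}$, such that any lasso program over $K^n$ whose loop implies $T$ under some assignment of the unknowns has no infinite execution. $T\equiv\bigwedge_{i\in I}\bigvee_{j\in J_i}T_{i,j}$, each occurrence written as $d_{i,j}^T(x;x')\rhd_{i,j}e_{i,j}$, $d_{i,j}=(\sum_f\alpha_f s_f;\sum_f\beta_f s_f)$, $e_{i,j}=-(\sum_f(\alpha_f+\beta_f)t_f+\sum_d\gamma_d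 d)$. A symbol $f$ (variable $d$) occurs in an atom iff its coefficient $\alpha_f$ or $\beta_f$ ($\gamma_d$) there is nonzero. $C_5$: $L$ finite with $\rhd_\ell\in\{\ge,>\}$; $L'=L\times I\times M$; for $\ell'=(\ell,i,m)$ unknowns $s_{\ell'}\in K^n,t_{\ell'}\in K$, $\psi_{\ell'}(x)\equiv s_{\ell'}^Tx+t_{\ell'}\rhd_\ell0$. Read $\neg(a\ge b)$ as $a<b$, $\neg(a>b)$ as $a\le b$. (II4): for $\ell'\in L',\nu\in N$: $\forall x.\neg(B_\nu x\le b_\nu\wedge B'_\nu x<b'_\nu\wedge\neg\psi_{\ell'}(x))$. (IC4): for $\ell'\in L',m\in M$: $\forall x,x'.\neg(\psi_{\ell'}(x)\wedge A_m(x;x')\le c_m\wedge A'_m(x;x')<c'_m\wedge\neg\psi_{\ell'}(x'))$. (TI4): for $i\in I,m\in M$: $\forall x,x'.\neg(A_m(x;x')\le c_m\wedge A'_m(x;x')<c'_m\wedge\bigwedge_{\ell\in L}\psi_{(\ell,i,m)}(x)\wedge\bigwedge_{j\in J_i}\neg T_{i,j}(x,x'))$. In each, with $z$ the quantified vector, write each conjunct inside $\neg(\ldots)$ (matrix rows separately) as $p_k^Tz\le q_k$ ($k\in R_\le$) or $p_k^Tz<q_k$ ($k\in R_<$), collecting $z$-terms on the left without rescaling; the Motzkin transform is $\exists(\kappa_k)_k\ge0.\ \sum_k\kappa_kp_k=0\wedge\sum_k\kappa_kq_k\le0\wedge(\sum_{k\in R_\le}\kappa_kq_k<0\vee\sum_{k\in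 R_<}\kappa_k>0)$, $\kappa_k$ being the Motzkin coefficient of the $k$-th inequality. $C_5$ is the conjunction of the transforms (fresh coefficients each) of all formulas of (II4),(IC4),(TI4). Colorings: dependency graph $G_T$ on $D\cup F$ with an undirected edge between $u,v$ iff some atom contains both. A coloring $\eta$ maps each occurrence $T_{i,j}$ to white (uncolored), red or blue. Coloring graph $G_\eta$: nodes are connected components of $G_T$; directed edge $([u],[v])$ iff for some $i$, $u$ occurs in a red and $v$ in a blue occurrence of conjunct $i$. $\eta$ is suitable iff (a) each conjunct has exactly one red occurrence; (b) any $u,v$ occurring in two different blue occurrences are not connected by a path in $G_T$; (c) $G_\eta$ is acyclic. $\deg_T(\eta)$ is the number of uncolored occurrences; the degree of $T$ is the minimum of $\deg_T(\eta)$ over suitable colorings $\eta$. -}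

module Defs where

open import Level using (0ℓ)
open import Data.Nat as ℕ using (ℕ; zero; suc)
open import Data.Fin as Fin using (Fin; splitAt)
open import Data.Bool using (Bool; true; false)
open import Data.Product using (Σ; ∃; ∃-syntax; _×_; _,_; proj₁; proj₂)
open import Data.Sum using (_⊎_; inj₁; inj₂; [_,_]′)
open import Data.Unit using (⊤)
open import Data.Empty using (⊥)
open import Data.List as List using (List; []; _∷_; [_]; map; concatMap; allFin; upTo; zipWith; foldr)
import Data.Vec.Functional as VF
open import Relation.Nullary using (¬_)
open import Relation.Binary.PropositionalEquality using (_≡_; _≢_)
open import Relation.Binary.Structures using (IsTotalOrder)
open import Relation.Binary.Construct.Closure.ReflexiveTransitive using (Star)
open import Relation.Binary.Construct.Closure.Transitive using (TransClosure)
open import Algebra.Structures using (IsCommutativeRing)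

-- Ordered fields (covers ℚ and every real closed field)

record OrderedField : Set₁ where
  infixl 6 _+_
  infixl 7 _*_
  infix 4 _≤_ _<_
  field
    Carrier : Set
    _+_ _*_ : Carrier → Carrier → Carrier
    -_      : Carrier → Carrier
    0# 1#   : Carrier
    _≤_     : Carrier → Carrier → Set
    isCommutativeRing : IsCommutativeRing _≡_ _+_ _*_ -_ 0# 1#
    0≢1     : 0# ≢ 1#
    inverse : ∀ x → x ≢ 0# → ∃[ y ] (x * y ≡ 1#)
    isTotalOrder : IsTotalOrder _≡_ _≤_
    +-mono  : ∀ x y z → x ≤ y → x + z ≤ y + z
    *-nonneg : ∀ x y → 0# ≤ x → 0# ≤ y → 0# ≤ x * y
  _<_ : Carrier → Carrier → Set
  x < y = x ≤ y × x ≢ y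

data Rhd : Set where
  ge gt : Rhd

module Over (𝕂 : OrderedField) where
  open OrderedField 𝕂 renaming (Carrier to K)

  Vec : ℕ → Set
  Vec k = Fin k → K

  sumF : ∀ {k} → (Fin k → K) → K
  sumF {zero}  g = 0#
  sumF {suc k} g = g Fin.zero + sumF (λ i → g (Fin.suc i))

  dot : ∀ {k} → Vec k → Vec k → K
  dot u v = sumF (λ i → u i * v i)

  -- Linear lasso programs in normal form

  record LinSys (k : ℕ) : Set where
    field
      r r' : ℕ
      A    : Fin r → Vec k
      a    : Fin r → K
      A'   : Fin r' → Vec k
      a'   : Fin r' → K

  HoldsSys : ∀ {k} → LinSys k → Vec k → Set
  HoldsSys S z = (∀ ρ → dot (A ρ) z ≤ a ρ) × (∀ ρ → dot (A' ρ) z < a' ρ)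
    where open LinSys S

  -- stem(x) ≡ ⋁_{ν∈N} (B_ν x ≤ b_ν ∧ B'_ν x < b'_ν),
  -- loop(x,x') ≡ ⋁_{m∈M} (A_m (x;x') ≤ c_m ∧ A'_m (x;x') < c'_m)
  record Lasso (n : ℕ) : Set where
    field
      nN nM : ℕ
      stem  : Fin nN → LinSys n
      loop  : Fin nM → LinSys (n ℕ.+ n)

  StemH : ∀ {n} → Lasso n → Vec n → Set
  StemH P x = ∃[ ν ] HoldsSys (Lasso.stem P ν) x

  LoopH : ∀ {n} → Lasso n → Vec n → Vec n → Set
  LoopH P x x' = ∃[ m ] HoldsSys (Lasso.loop P m) (x VF.++ x')

  HasInfiniteExecution : ∀ {n} → Lasso n → Set
  HasInfiniteExecution {n} P =
    Σ (ℕ → Vec n) λ xs → (StemH P (xs 0) × (∀ i → LoopH P (xs i) (xs (suc i))))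

  -- Linear ranking function templates in CNF  ⋀_{i∈I} ⋁_{j∈J_i} T_{i,j}
  -- F = Fin nF (affine function symbols), D = Fin nD (unknown scalars)

  -- atom  Σ_f (α_f f(x) + β_f f(x')) + Σ_d γ_d d ▷ 0
  record Atom (nF nD : ℕ) : Set where
    field
      α β : Fin nF → K
      γ   : Fin nD → K
      rel : Rhd
      notAllZero : ¬ ((∀ f → α f ≡ 0#) × (∀ f → β f ≡ 0#) × (∀ d → γ d ≡ 0#))

  record Template : Set where
    field
      nF nD nI : ℕ
      J  : Fin nI → ℕ
      at : (i : Fin nI) → Fin (J i) → Atom nF nD

  record Assignment (n : ℕ) (T : Template) : Set where
    open Template T
    field
      s : Fin nF → Vec n
      t : Fin nF → K
      dval : Fin nD → K

  holdsRhd : Rhd → K → Set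
  holdsRhd ge v = 0# ≤ v
  holdsRhd gt v = 0# < v

  ⟦_⟧ : ∀ {n} (T : Template) → Assignment n T → Vec n → Vec n → Set
  ⟦ T ⟧ σ x x' = ∀ i → ∃[ j ] holdsRhd (Atom.rel (at i j)) (val (at i j))
    where
      open Template T
      open Assignment σ
      val : Atom nF nD → K
      val A = sumF (λ f → Atom.α A f * (dot (s f) x + t f)
                        + Atom.β A f * (dot (s f) x' + t f))
              + sumF (λ d → Atom.γ A d * dval d)

  IsRankingTemplate : ℕ → Template → Set
  IsRankingTemplate n T =
    (Q : Lasso n) → (∃[ σ ] (∀ x x' → LoopH Q x x' → ⟦ T ⟧ σ x x')) →
    ¬ HasInfiniteExecution Q

  data Color : Set where
    white red blue : Color

  module _ (T : Template) where
    open Template T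

    Occ : Set
    Occ = Σ (Fin nI) (λ i → Fin (J i))

    Coloring : Set
    Coloring = (i : Fin nI) → Fin (J i) → Color

    Sym : Set
    Sym = Fin nD ⊎ Fin nF

    OccursIn : Sym → Occ → Set
    OccursIn (inj₁ d) (i , j) = Atom.γ (at i j) d ≢ 0#
    OccursIn (inj₂ f) (i , j) = Atom.α (at i j) f ≢ 0# ⊎ Atom.β (at i j) f ≢ 0#

    EdgeT : Sym → Sym → Set
    EdgeT u v = ∃[ o ] (OccursIn u o × OccursIn v o)

    Connected : Sym → Sym → Set
    Connected = Star EdgeT

    -- edge of G_η, lifted to representatives of components
    EdgeEta : Coloring → Sym → Sym → Set
    EdgeEta η u v = ∃[ u' ] ∃[ v' ] ∃[ i ] ∃[ j ] ∃[ j' ]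
      (Connected u u' × Connected v v' ×
       η i j ≡ red × OccursIn u' (i , j) × η i j' ≡ blue × OccursIn v' (i , j'))

    record Suitable (η : Coloring) : Set where
      field
        oneRed : ∀ i → ∃[ j ] (η i j ≡ red × (∀ j' → η i j' ≡ red → j' ≡ j))
        blueSeparated : ∀ (o o' : Occ) → o ≢ o' →
          η (proj₁ o) (proj₂ o) ≡ blue → η (proj₁ o') (proj₂ o') ≡ blue →
          ∀ u v → OccursIn u o → OccursIn v o' → ¬ Connected u v
        acyclic : ∀ u → ¬ TransClosure (EdgeEta η) u u

    countF : ∀ {k} → (Fin k → ℕ) → ℕ
    countF {zero} g = 0
    countF {suc k} g = g Fin.zero ℕ.+ countF (λ i → g (Fin.suc i))

    isWhite : Color → ℕ
    isWhite white = 1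
    isWhite red   = 0
    isWhite blue  = 0

    degT : Coloring → ℕ
    degT η = countF (λ i → countF (λ j → isWhite (η i j)))

  module Syntax (n : ℕ) (T : Template) (nL : ℕ) (nN nM : ℕ) where
    open Template T

    L' : Set
    L' = Fin nL × Fin nI × Fin nM

    data Tag : Set where
      ii4 : L' → Fin nN → Tag
      ic4 : L' → Fin nM → Tag
      ti4 : Fin nI → Fin nM → Tag

    data Var : Set where
      sF   : Fin nF → Fin n → Var
      tF   : Fin nF → Var
      dV   : Fin nD → Var
      sL   : L' → Fin n → Var
      tL   : L' → Var
      kap  : Tag → ℕ → Var             -- Motzkin coefficient of k-th inequality

    infixl 6 _⊕_
    infixl 7 _⊗_
    data Term : Set where
      var  : Var → Term
      con  : K → Term
      _⊕_  : Term → Term → Term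
      _⊗_  : Term → Term → Term
      ⊖_   : Term → Term

    infix 4 _≤'_ _<'_ _≐_
    infixr 3 _∧'_
    infixr 2 _∨'_
    data Formula : Set where
      tt ff : Formula
      _≤'_ _<'_ _≐_ : Term → Term → Formula
      _∧'_ _∨'_ : Formula → Formula → Formula
      ex : Var → Formula → Formula

    ⋀ ⋁ : List Formula → Formula
    ⋀ = foldr _∧'_ tt
    ⋁ = foldr _∨'_ ff

    Σt : List Term → Term
    Σt = foldr _⊕_ (con 0#)

    Closed : Term → Set
    Closed (var _) = ⊥
    Closed (con _) = ⊤
    Closed (t ⊕ u) = Closed t × Closed u
    Closed (t ⊗ u) = Closed t × Closed u
    Closed (⊖ t)   = Closed t

    LinearTerm : Term → Set
    LinearTerm (var _) = ⊤
    LinearTerm (con _) = ⊤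
    LinearTerm (t ⊕ u) = LinearTerm t × LinearTerm u
    LinearTerm (t ⊗ u) = (Closed t ⊎ Closed u) × LinearTerm t × LinearTerm u
    LinearTerm (⊖ t)   = LinearTerm t

    Linear : Formula → Set
    Linear tt = ⊤
    Linear ff = ⊤
    Linear (t ≤' u) = LinearTerm t × LinearTerm u
    Linear (t <' u) = LinearTerm t × LinearTerm u
    Linear (t ≐ u)  = LinearTerm t × LinearTerm u
    Linear (φ ∧' ψ) = Linear φ × Linear ψ
    Linear (φ ∨' ψ) = Linear φ × Linear ψ
    Linear (ex _ φ) = Linear φ

    data Fixing : Set where
      free    : Fixing
      fixedTo : List K → Fixing

    -- an inequality  p^T z ≤ q  (strict = false)  or  p^T z < q  (strict = true)
    record Row (k : ℕ) : Set where
      constructor row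
      field
        p      : Fin k → Term
        q      : Term
        strict : Bool
        fix    : Fixing

    choices : {A : Set} → List (List A) → List (List A)
    choices []         = [ [] ]
    choices (xs ∷ xss) = concatMap (λ x → map (x ∷_) (choices xss)) xs

    module _ {k : ℕ} (τ : Tag) (rows : List (Row k)) where
      indexed : List (ℕ × Row k)
      indexed = zipWith _,_ (upTo (List.length rows)) rows

      options : ℕ × Row k → List Term
      options (ι , row _ _ _ free)        = [ var (kap τ ι) ]
      options (ι , row _ _ _ (fixedTo U)) = map con U

      freeVars : ℕ × Row k → List Var
      freeVars (ι , row _ _ _ free)      = [ kap τ ι ]
      freeVars (ι , row _ _ _ (fixedTo _)) = []

      body : List Term → Formula
      body κs =
        ⋀ (map (λ κ → con 0# ≤' κ) κs) ∧'
        (⋀ (List.tabulate {n = k} (λ c → Σt (zipWith (λ κ ρ → κ ⊗ Row.p ρ c) κs rows) ≐ con 0#)) ∧'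
        (Σt (zipWith (λ κ ρ → κ ⊗ Row.q ρ) κs rows) ≤' con 0# ∧'
        (Σt (zipWith (λ κ ρ → nonstrictPart κ ρ) κs rows) <' con 0# ∨'
         con 0# <' Σt (zipWith strictPart κs rows))))
        where
          nonstrictPart : Term → Row k → Term
          nonstrictPart κ (row _ q false _) = κ ⊗ q
          nonstrictPart κ (row _ q true  _) = con 0#
          strictPart : Term → Row k → Term
          strictPart κ (row _ _ true  _) = κ
          strictPart κ (row _ _ false _) = con 0#

      -- ∃ (free κ) . ⋁_{fixed choices} body
      motzkin : Formula
      motzkin = foldr ex (⋁ (map body (choices (map options indexed))))
                         (concatMap freeVars indexed)

    onX onX' : (Fin n → Term) → Fin (n ℕ.+ n) → Term
    onX  g c = [ g , (λ _ → con 0#) ]′ (splitAt n c)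
    onX' g c = [ (λ _ → con 0#) , g ]′ (splitAt n c)

    sysRows : ∀ {k} → LinSys k → List (Row k)
    sysRows S =
      List.tabulate (λ ρ → row (λ c → con (A ρ c)) (con (a ρ)) false free) List.++
      List.tabulate (λ ρ → row (λ c → con (A' ρ c)) (con (a' ρ)) true free)
      where open LinSys S

    sVec : L' → Fin n → Term
    sVec ℓ' c = var (sL ℓ' c)

    -- ψ_ℓ'(x) ≡ s^T x + t ▷ 0, written  (-s)^T x ≤/< t
    psiRow : ∀ {k} → Rhd → ((Fin n → Term) → Fin k → Term) → L' → Fixing → Row k
    psiRow ge emb ℓ' φ = row (emb (λ c → ⊖ sVec ℓ' c)) (var (tL ℓ')) false φ
    psiRow gt emb ℓ' φ = row (emb (λ c → ⊖ sVec ℓ' c)) (var (tL ℓ')) true φ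

    -- ¬ψ_ℓ'(x), written  s^T x </≤ -t
    negPsiRow : ∀ {k} → Rhd → ((Fin n → Term) → Fin k → Term) → L' → Fixing → Row k
    negPsiRow ge emb ℓ' φ = row (emb (sVec ℓ')) (⊖ var (tL ℓ')) true φ
    negPsiRow gt emb ℓ' φ = row (emb (sVec ℓ')) (⊖ var (tL ℓ')) false φ

    -- ¬T_{i,j}, with T_{i,j} ≡ d^T (x;x') ▷ e, written  d^T (x;x') </≤ e
    negTRow : (i : Fin nI) → Fin (J i) → Fixing → Row (n ℕ.+ n)
    negTRow i j φ = row dvec e (strictOf (Atom.rel A)) φ
      where
        A = at i j
        dvec : Fin (n ℕ.+ n) → Term
        dvec c = [ (λ c₀ → Σt (List.tabulate (λ f → con (Atom.α A f) ⊗ var (sF f c₀))))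
                 , (λ c₀ → Σt (List.tabulate (λ f → con (Atom.β A f) ⊗ var (sF f c₀)))) ]′
                 (splitAt n c)
        e : Term
        e = ⊖ (Σt (List.tabulate (λ f → con (Atom.α A f + Atom.β A f) ⊗ var (tF f)))
               ⊕ Σt (List.tabulate (λ d → con (Atom.γ A d) ⊗ var (dV d))))
        strictOf : Rhd → Bool
        strictOf ge = true
        strictOf gt = false

    record FixPolicy : Set where
      field
        ii4NegPsi   : Fixing
        ic4Psi      : Fixing
        ic4NegPsi'  : Fixing
        ti4NegT     : (i : Fin nI) → Fin (J i) → Fixing
        ti4Psi      : Fin nL → Fixing

    allL' : List L'
    allL' = List.cartesianProduct (allFin nL) (List.cartesianProduct (allFin nI) (allFin nM))

    module Build (stem : Fin nN → LinSys n) (loop : Fin nM → LinSys (n ℕ.+ n))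
                 (rhd : Fin nL → Rhd) (pol : FixPolicy) where
      open FixPolicy pol

      rhdOf : L' → Rhd
      rhdOf (ℓ , _) = rhd ℓ

      II4 : L' → Fin nN → Formula
      II4 ℓ' ν = motzkin (ii4 ℓ' ν)
        (sysRows (stem ν) List.++ [ negPsiRow (rhdOf ℓ') (λ g → g) ℓ' ii4NegPsi ])

      IC4 : L' → Fin nM → Formula
      IC4 ℓ' m = motzkin (ic4 ℓ' m)
        (psiRow (rhdOf ℓ') onX ℓ' ic4Psi ∷
         sysRows (loop m) List.++ [ negPsiRow (rhdOf ℓ') onX' ℓ' ic4NegPsi' ])

      TI4 : Fin nI → Fin nM → Formula
      TI4 i m = motzkin (ti4 i m)
        (sysRows (loop m) List.++
         List.tabulate (λ ℓ → psiRow (rhd ℓ) onX (ℓ , i , m) (ti4Psi ℓ)) List.++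
         List.tabulate (λ j → negTRow i j (ti4NegT i j)))

      constraint : Formula
      constraint =
        ⋀ (concatMap (λ ℓ' → map (II4 ℓ') (allFin nN)) allL') ∧'
        (⋀ (concatMap (λ ℓ' → map (IC4 ℓ') (allFin nM)) allL') ∧'
         ⋀ (concatMap (λ i → map (TI4 i) (allFin nM)) (allFin nI)))

  module _ {n : ℕ} (P : Lasso n) (T : Template) (nL : ℕ) (rhd : Fin nL → Rhd) where
    open Lasso P
    open Syntax n T nL nN nM public

    noFixing : FixPolicy
    noFixing = record
      { ii4NegPsi = free ; ic4Psi = free ; ic4NegPsi' = free
      ; ti4NegT = λ _ _ → free ; ti4Psi = λ _ → free }

    C₅ : Formula
    C₅ = Build.constraint stem loop rhd noFixing

    zeroOne one : Fixing
    zeroOne = fixedTo (0# ∷ 1# ∷ [])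
    one     = fixedTo [ 1# ]

    policy6 : Coloring T → FixPolicy
    policy6 η = record
      { ii4NegPsi  = zeroOne
      ; ic4Psi     = one
      ; ic4NegPsi' = zeroOne
      ; ti4NegT    = λ i j → colored (η i j)
      ; ti4Psi     = λ ℓ → byRhd (rhd ℓ) }
      where
        colored : Color → Fixing
        colored white = free
        colored red   = zeroOne
        colored blue  = zeroOne
        byRhd : Rhd → Fixing
        byRhd gt = zeroOne
        byRhd ge = one

    C₆' : Coloring T → Formula
    C₆' η = Build.constraint stem loop rhd (policy6 η)

-- The only source of non-linearity in a Motzkin transform is a product
-- κ · e of a Motzkin coefficient κ with an entry e of its inequality row.
-- Such a product is linear as soon as κ is a constant or e is.  Hence a
-- Motzkin transform is linear provided every row whose entries involve
-- unknowns has its coefficient fixed to a finite set of constants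
-- (`motzkin-linear`).  The constraint assembled by `Build` is therefore
-- linear for every fixing policy that fixes the coefficients of all the
-- rows mentioning unknowns, namely ¬ψ in (II4), ψ and ¬ψ' in (IC4), and
-- ψ and ¬T_{i,j} in (TI4) (`constraint-linear`); the rows coming from
-- stem and loop are constant.  The policy defining C₆' fixes all of them
-- except ¬T_{i,j} for uncoloured occurrences, and a colouring of degree 0
-- leaves no occurrence uncoloured (`degree-zero⇒coloured`).

module Submission where

open import Defs
open import Data.Nat as ℕ using (ℕ; suc)
open import Data.Nat.Properties using (suc-injective; m+n≡0⇒m≡0; m+n≡0⇒n≡0)
open import Data.Fin using (Fin; splitAt)
open import Data.Product using (_×_; _,_)
open import Data.Sum using (_⊎_; inj₁; inj₂)
open import Data.Unit using (⊤; tt)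
open import Data.Empty using (⊥)
open import Data.Bool using (true; false)
open import Data.List as List using (List; []; _∷_; map; concatMap; zipWith; upTo; allFin)
import Data.List.Properties as ListP
open import Data.List.Relation.Unary.All as All using (All; []; _∷_)
import Data.List.Relation.Unary.All.Properties as AllP
open import Data.List.Relation.Binary.Pointwise as Pointwise using (Pointwise; []; _∷_)
open import Relation.Binary.PropositionalEquality using (_≡_)

pointwise-left : {A B : Set} {R : A → B → Set} {P : A → Set} →
  (∀ {x y} → R x y → P x) → ∀ {xs ys} → Pointwise R xs ys → All P xs
pointwise-left R⇒P [] = []
pointwise-left R⇒P (r ∷ rs) = R⇒P r ∷ pointwise-left R⇒P rs

module _ (𝕂 : OrderedField) where
  open OrderedField 𝕂 using () renaming (Carrier to K)
  open Over 𝕂 using ( Template; Coloring; countF; degT; isWhite; white; red; blue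
                    ; LinSys; Lasso; policy6; module Syntax )

  countF≡0 : (T : Template) {k : ℕ} (g : Fin k → ℕ) → countF T g ≡ 0 → ∀ i → g i ≡ 0
  countF≡0 T {suc k} g sum≡0 Fin.zero = m+n≡0⇒m≡0 (g Fin.zero) sum≡0
  countF≡0 T {suc k} g sum≡0 (Fin.suc i) =
    countF≡0 T (λ i → g (Fin.suc i)) (m+n≡0⇒n≡0 (g Fin.zero) sum≡0) i

  degree-zero⇒coloured : (T : Template) (η : Coloring T) → degT T η ≡ 0 →
    ∀ i j → isWhite T (η i j) ≡ 0
  degree-zero⇒coloured T η deg≡0 i j =
    countF≡0 T (λ j → isWhite T (η i j))
      (countF≡0 T (λ i → countF T (λ j → isWhite T (η i j))) deg≡0 i) j

  module Linearity (n : ℕ) (T : Template) (nL nN nM : ℕ) where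
    open Template T
    open Syntax n T nL nN nM hiding (tt)

    choices-pointwise : {A B : Set} (R : A → B → Set) {xss : List (List A)} {bs : List B} →
      Pointwise (λ xs b → All (λ x → R x b) xs) xss bs →
      All (λ xs → Pointwise R xs bs) (choices xss)
    choices-pointwise R [] = [] ∷ []
    choices-pointwise R {xs ∷ xss} {b ∷ bs} (rxs ∷ rxss) =
      AllP.concat⁺ (AllP.map⁺ (extend xs rxs))
      where
      extend : ∀ ys → All (λ y → R y b) ys →
        All (λ y → All (λ zs → Pointwise R zs (b ∷ bs)) (map (y ∷_) (choices xss))) ys
      extend [] [] = []
      extend (y ∷ ys) (ry ∷ rys) =
        AllP.map⁺ (All.map (ry ∷_) (choices-pointwise R rxss)) ∷ extend ys rys

    Σt-linear : ∀ {ts} → All LinearTerm ts → LinearTerm (Σt ts)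
    Σt-linear [] = tt
    Σt-linear (lt ∷ lts) = lt , Σt-linear lts

    ⋀-linear : ∀ {φs} → All Linear φs → Linear (⋀ φs)
    ⋀-linear [] = tt
    ⋀-linear (lφ ∷ lφs) = lφ , ⋀-linear lφs

    ⋁-linear : ∀ {φs} → All Linear φs → Linear (⋁ φs)
    ⋁-linear [] = tt
    ⋁-linear (lφ ∷ lφs) = lφ , ⋁-linear lφs

    ex-linear : ∀ (vs : List Var) {φ} → Linear φ → Linear (List.foldr ex φ vs)
    ex-linear [] lφ = lφ
    ex-linear (_ ∷ vs) lφ = ex-linear vs lφ

    weighted-sum-linear : ∀ m (c : Fin m → K) (v : Fin m → Var) →
      LinearTerm (Σt (List.tabulate (λ f → con (c f) ⊗ var (v f))))
    weighted-sum-linear m c v =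
      Σt-linear (AllP.tabulate⁺ {f = λ f → con (c f) ⊗ var (v f)} (λ _ → inj₁ tt , tt , tt))

    LinearRow : ∀ {k} → Row k → Set
    LinearRow ρ = (∀ c → LinearTerm (Row.p ρ c)) × LinearTerm (Row.q ρ)

    ConstantRow : ∀ {k} → Row k → Set
    ConstantRow ρ = (∀ c → Closed (Row.p ρ c)) × Closed (Row.q ρ)

    Fixed : Fixing → Set
    Fixed free = ⊥
    Fixed (fixedTo _) = ⊤

    Admissible : ∀ {k} → Row k → Set
    Admissible ρ = LinearRow ρ × (ConstantRow ρ ⊎ Fixed (Row.fix ρ))

    record Compatible {k} (κ : Term) (ρ : Row k) : Set where
      constructor compatible
      field
        coefficient-linear : LinearTerm κ
        constant-factor    : Closed κ ⊎ ConstantRow ρ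
        row-linear         : LinearRow ρ

    scale-p-linear : ∀ {k} {κ} {ρ : Row k} → Compatible κ ρ → ∀ c → LinearTerm (κ ⊗ Row.p ρ c)
    scale-p-linear (compatible lκ (inj₁ cκ) (lp , _)) c = inj₁ cκ , lκ , lp c
    scale-p-linear (compatible lκ (inj₂ (cp , _)) (lp , _)) c = inj₂ (cp c) , lκ , lp c

    scale-q-linear : ∀ {k} {κ} {ρ : Row k} → Compatible κ ρ → LinearTerm (κ ⊗ Row.q ρ)
    scale-q-linear (compatible lκ (inj₁ cκ) (_ , lq)) = inj₁ cκ , lκ , lq
    scale-q-linear (compatible lκ (inj₂ (_ , cq)) (_ , lq)) = inj₂ cq , lκ , lq

    options-compatible : ∀ {k} (τ : Tag) (rows : List (Row k)) ι (ρ : Row k) →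
      Admissible ρ → All (λ κ → Compatible κ ρ) (options τ rows (ι , ρ))
    options-compatible τ rows ι (row p q s free) (lρ , inj₁ cρ) =
      compatible tt (inj₂ cρ) lρ ∷ []
    options-compatible τ rows ι (row p q s (fixedTo U)) (lρ , _) =
      AllP.map⁺ (All.universal (λ _ → compatible tt (inj₁ tt) lρ) U)

    indexed-compatible : ∀ {k} (τ : Tag) (rows : List (Row k)) ns (rs : List (Row k)) →
      List.length ns ≡ List.length rs → All Admissible rs →
      Pointwise (λ κs ρ → All (λ κ → Compatible κ ρ) κs)
                (map (options τ rows) (zipWith _,_ ns rs)) rs
    indexed-compatible τ rows [] [] _ [] = []
    indexed-compatible τ rows (ι ∷ ns) (ρ ∷ rs) len (aρ ∷ ars) =
      options-compatible τ rows ι ρ aρ ∷ indexed-compatible τ rows ns rs (suc-injective len) ars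

    body-linear : ∀ {k} (τ : Tag) (rows : List (Row k)) {κs} →
      Pointwise Compatible κs rows → Linear (body τ rows κs)
    body-linear {k} τ rows {κs} compat =
      ⋀-linear (AllP.map⁺ (pointwise-left (λ c → tt , Compatible.coefficient-linear c) compat)) ,
      ⋀-linear (AllP.tabulate⁺ (λ c → sum (λ cκ → scale-p-linear cκ c) , tt)) ,
      (sum scale-q-linear , tt) ,
      (sum (λ { {ρ = row _ _ false _} cκ → scale-q-linear cκ
              ; {ρ = row _ _ true _} cκ → tt }) , tt) ,
      (tt , sum (λ { {ρ = row _ _ true _} cκ → Compatible.coefficient-linear cκ
                   ; {ρ = row _ _ false _} cκ → tt }))
      where
      sum : {h : Term → Row k → Term} → (∀ {κ ρ} → Compatible κ ρ → LinearTerm (h κ ρ)) →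
            LinearTerm (Σt (zipWith h κs rows))
      sum {h} lh = Σt-linear (AllP.zipWith⁺ h (Pointwise.map lh compat))

    motzkin-linear : ∀ {k} (τ : Tag) (rows : List (Row k)) → All Admissible rows →
      Linear (motzkin τ rows)
    motzkin-linear τ rows admissible =
      ex-linear (concatMap (freeVars τ rows) (indexed τ rows))
        (⋁-linear (AllP.map⁺ {f = body τ rows} (All.map (body-linear τ rows)
          (choices-pointwise Compatible
            (indexed-compatible τ rows (upTo (List.length rows)) rows
              (ListP.length-upTo _) admissible)))))

    PreservesLinearity : ∀ {k} → ((Fin n → Term) → Fin k → Term) → Set
    PreservesLinearity emb = ∀ g → (∀ c → LinearTerm (g c)) → ∀ c → LinearTerm (emb g c)

    id-preserves : PreservesLinearity (λ g → g)
    id-preserves g lg = lg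

    onX-preserves : PreservesLinearity onX
    onX-preserves g lg c with splitAt n c
    ... | inj₁ c₀ = lg c₀
    ... | inj₂ _ = tt

    onX'-preserves : PreservesLinearity onX'
    onX'-preserves g lg c with splitAt n c
    ... | inj₁ _ = tt
    ... | inj₂ c₀ = lg c₀

    sysRows-admissible : ∀ {k} (S : LinSys k) → All Admissible (sysRows S)
    sysRows-admissible S =
      AllP.++⁺ (AllP.tabulate⁺ (λ ρ → constant (A ρ) (a ρ) false))
               (AllP.tabulate⁺ (λ ρ → constant (A' ρ) (a' ρ) true))
      where
      open LinSys S
      constant : ∀ {k} (p : Fin k → K) q s → Admissible (row (λ c → con (p c)) (con q) s free)
      constant p q s = ((λ _ → tt) , tt) , inj₁ ((λ _ → tt) , tt)

    psiRow-admissible : ∀ {k} r {emb : (Fin n → Term) → Fin k → Term} → PreservesLinearity emb →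
      ∀ ℓ' {φ} → Fixed φ → Admissible (psiRow r emb ℓ' φ)
    psiRow-admissible ge pres ℓ' fixed = (pres (λ c → ⊖ sVec ℓ' c) (λ _ → tt) , tt) , inj₂ fixed
    psiRow-admissible gt pres ℓ' fixed = (pres (λ c → ⊖ sVec ℓ' c) (λ _ → tt) , tt) , inj₂ fixed

    negPsiRow-admissible : ∀ {k} r {emb : (Fin n → Term) → Fin k → Term} → PreservesLinearity emb →
      ∀ ℓ' {φ} → Fixed φ → Admissible (negPsiRow r emb ℓ' φ)
    negPsiRow-admissible ge pres ℓ' fixed = (pres (sVec ℓ') (λ _ → tt) , tt) , inj₂ fixed
    negPsiRow-admissible gt pres ℓ' fixed = (pres (sVec ℓ') (λ _ → tt) , tt) , inj₂ fixed

    negTRow-admissible : ∀ i j {φ} → Fixed φ → Admissible (negTRow i j φ)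
    negTRow-admissible i j {φ} fixed =
      (d-linear , weighted-sum-linear nF _ _ , weighted-sum-linear nD _ _) , inj₂ fixed
      where
      d-linear : ∀ c → LinearTerm (Row.p (negTRow i j φ) c)
      d-linear c with splitAt n c
      ... | inj₁ _ = weighted-sum-linear nF _ _
      ... | inj₂ _ = weighted-sum-linear nF _ _

    record FixesUnknownRows (pol : FixPolicy) : Set where
      open FixPolicy pol
      field
        fixes-ii4NegPsi  : Fixed ii4NegPsi
        fixes-ic4Psi     : Fixed ic4Psi
        fixes-ic4NegPsi' : Fixed ic4NegPsi'
        fixes-ti4NegT    : ∀ i j → Fixed (ti4NegT i j)
        fixes-ti4Psi     : ∀ ℓ → Fixed (ti4Psi ℓ)

    ⋀-grid-linear : {A B : Set} (g : A → B → Formula) (xs : List A) (ys : List B) →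
      (∀ a b → Linear (g a b)) → Linear (⋀ (concatMap (λ a → map (g a) ys) xs))
    ⋀-grid-linear g xs ys lg =
      ⋀-linear (AllP.concat⁺ (AllP.map⁺
        (All.universal (λ a → AllP.map⁺ (All.universal (lg a) ys)) xs)))

    constraint-linear : (stem : Fin nN → LinSys n) (loop : Fin nM → LinSys (n ℕ.+ n))
      (rhd : Fin nL → Rhd) (pol : FixPolicy) → FixesUnknownRows pol →
      Linear (Build.constraint stem loop rhd pol)
    constraint-linear stem loop rhd pol fixes =
      ⋀-grid-linear II4 allL' (allFin nN) II4-linear ,
      ⋀-grid-linear IC4 allL' (allFin nM) IC4-linear ,
      ⋀-grid-linear TI4 (allFin nI) (allFin nM) TI4-linear
      where
      open Build stem loop rhd pol
      open FixesUnknownRows fixes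

      II4-linear : ∀ ℓ' ν → Linear (II4 ℓ' ν)
      II4-linear ℓ' ν = motzkin-linear _ _ (AllP.++⁺ (sysRows-admissible (stem ν))
        (negPsiRow-admissible (rhdOf ℓ') id-preserves ℓ' fixes-ii4NegPsi ∷ []))

      IC4-linear : ∀ ℓ' m → Linear (IC4 ℓ' m)
      IC4-linear ℓ' m = motzkin-linear _ _
        (psiRow-admissible (rhdOf ℓ') onX-preserves ℓ' fixes-ic4Psi ∷
         AllP.++⁺ (sysRows-admissible (loop m))
           (negPsiRow-admissible (rhdOf ℓ') onX'-preserves ℓ' fixes-ic4NegPsi' ∷ []))

      TI4-linear : ∀ i m → Linear (TI4 i m)
      TI4-linear i m = motzkin-linear _ _ (AllP.++⁺ (sysRows-admissible (loop m)) (AllP.++⁺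
        (AllP.tabulate⁺ (λ ℓ →
          psiRow-admissible (rhd ℓ) onX-preserves (ℓ , i , m) (fixes-ti4Psi ℓ)))
        (AllP.tabulate⁺ (λ j → negTRow-admissible i j (fixes-ti4NegT i j)))))

  policy6-fixes-unknown-rows : ∀ {n} (P : Lasso n) (T : Template) (nL : ℕ) (rhd : Fin nL → Rhd)
    (η : Coloring T) → degT T η ≡ 0 →
    Linearity.FixesUnknownRows n T nL (Lasso.nN P) (Lasso.nM P) (policy6 P T nL rhd η)
  policy6-fixes-unknown-rows {n} P T nL rhd η deg≡0 = record
    { fixes-ii4NegPsi  = tt
    ; fixes-ic4Psi     = tt
    ; fixes-ic4NegPsi' = tt
    ; fixes-ti4NegT    = coloured-fixed
    ; fixes-ti4Psi     = comparison-fixed }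
    where
    open Linearity n T nL (Lasso.nN P) (Lasso.nM P) using (Fixed)
    open Syntax n T nL (Lasso.nN P) (Lasso.nM P) using (module FixPolicy)
    open FixPolicy (policy6 P T nL rhd η)

    coloured-fixed : ∀ i j → Fixed (ti4NegT i j)
    coloured-fixed i j with η i j | degree-zero⇒coloured T η deg≡0 i j
    ... | red  | _ = tt
    ... | blue | _ = tt
    ... | white | ()

    comparison-fixed : ∀ ℓ → Fixed (ti4Psi ℓ)
    comparison-fixed ℓ with rhd ℓ
    ... | ge = tt
    ... | gt = tt

corollary6p23 : (𝕂 : OrderedField) → let open Over 𝕂 in
    (n : ℕ) (P : Lasso n) (T : Template) → IsRankingTemplate n T →
    (nL : ℕ) (rhd : Fin nL → Rhd) →
    (η : Coloring T) → Suitable T η → degT T η ≡ 0 →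
    Linear P T nL rhd (C₆' P T nL rhd η)
corollary6p23 𝕂 n P T _ nL rhd η _ deg≡0 =
  constraint-linear (Lasso.stem P) (Lasso.loop P) rhd (policy6 P T nL rhd η)
    (policy6-fixes-unknown-rows 𝕂 P T nL rhd η deg≡0)
  where
  open Over 𝕂 using (Lasso; policy6)
  open Linearity 𝕂 n T nL (Lasso.nN P) (Lasso.nM P) using (constraint-linear)
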